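{- Let $n$ be a positive integer and $p,q$ primes such that $\binom{n}{k}$ is divisible by $p$ or $q$ for every integer $k$ with $1\le k\le n-1$. Then for every integer $m\le n$, and all integers $k_1,\dots,k_m$ with $1\le k_i\le n-1$ for all $i$ and $k_1+\dots+k_m=n$, the multinomial coefficient $\frac{n!}{k_1!k_2!\cdots k_m!}$ is divisible by $p$ or by $q$. -}

module Defs where

open import Data.Nat using (ℕ; zero; suc; _*_; _/_; NonZero; _!)
open import Data.Nat.Properties using (m*n≢0)
open import Data.Nat.Properties using (_!≢0)
open import Data.Vec using (Vec; []; _∷_)

factorialProduct : ∀ {m} → Vec ℕ m → ℕ
factorialProduct []       = 1
factorialProduct (k ∷ ks) = k ! * factorialProduct ks

factorialProduct≢0 : ∀ {m} (ks : Vec ℕ m) → NonZero (factorialProduct ks)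
factorialProduct≢0 []       = _
factorialProduct≢0 (k ∷ ks) =
  m*n≢0 (k !) (factorialProduct ks) {{k !≢0}} {{factorialProduct≢0 ks}}

-- multinomial coefficient  n! / (k₁! k₂! ⋯ kₘ!)  (exact division when Σ kᵢ = n)
multinomial : ℕ → ∀ {m} → Vec ℕ m → ℕ
multinomial n ks = (n !) / factorialProduct ks
  where instance _ = factorialProduct≢0 ks

module Submission where

-- Proof idea.  Write n = k₁ + (k₂ + ⋯ + kₘ).  The multinomial coefficient
-- n!/(k₁!⋯kₘ!) is a multiple of the binomial coefficient n C k₁, because
--
--     (n C k₁) · k₁! · (k₂!⋯kₘ!)  divides  (n C k₁) · k₁! · (n − k₁)!  =  n!,
--
-- where k₂!⋯kₘ! ∣ (k₂ + ⋯ + kₘ)! is the integrality of multinomial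
-- coefficients.  Hence every divisor of n C k₁ divides the multinomial
-- coefficient.  Since 1 ≤ k₁ ≤ n − 1, the hypothesis gives p ∣ n C k₁ or
-- q ∣ n C k₁, and the theorem follows (the list of parts is nonempty as n ≥ 1).

open import Defs
open import Data.Nat using (ℕ; _≤_; _∸_; _+_; _*_; _/_; _!; NonZero; suc)
open import Data.Nat.Combinatorics using (_C_; k![n∸k]!∣n!)
open import Data.Nat.Combinatorics.Specification using (nCk≡n!/k![n-k]!)
open import Data.Nat.Divisibility using (_∣_; ∣-trans; ∣-refl; *-monoʳ-∣; m*n∣o⇒m∣o/n)
open import Data.Nat.DivMod using (m/n*n≡m)
open import Data.Nat.Properties using (m+n∸m≡n; m≤m+n; _!≢0; m*n≢0)
open import Data.Nat.Primality using (Prime)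
open import Data.Vec using (Vec; sum; []; _∷_)
open import Data.Vec.Relation.Unary.All using (All; _∷_)
open import Relation.Binary.PropositionalEquality using (_≡_; refl; subst; cong; sym)
open import Data.Sum using (_⊎_; map)
open import Data.Product using (_×_; _,_)

open Relation.Binary.PropositionalEquality.≡-Reasoning

binomial*factorials≡factorial : ∀ {n k} → k ≤ n → (n C k) * (k ! * (n ∸ k) !) ≡ n !
binomial*factorials≡factorial {n} {k} k≤n = begin
  (n C k) * (k ! * (n ∸ k) !)                 ≡⟨ cong (_* (k ! * (n ∸ k) !)) (nCk≡n!/k![n-k]! k≤n) ⟩
  (n ! / (k ! * (n ∸ k) !)) * (k ! * (n ∸ k) !) ≡⟨ m/n*n≡m (k![n∸k]!∣n! k≤n) ⟩
  n !                                         ∎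
  where
  instance
    k![n∸k]!≢0 : NonZero (k ! * (n ∸ k) !)
    k![n∸k]!≢0 = m*n≢0 (k !) ((n ∸ k) !) {{k !≢0}} {{(n ∸ k) !≢0}}

-- Integrality of multinomial coefficients: k₁! ⋯ kₘ! divides (k₁ + ⋯ + kₘ)!.
-- Inductively, k! · (Σ ks)! divides (k + Σ ks)! since the quotient is a binomial coefficient.
factorialProduct∣sum! : ∀ {m} (ks : Vec ℕ m) → factorialProduct ks ∣ (sum ks) !
factorialProduct∣sum! []       = ∣-refl
factorialProduct∣sum! (k ∷ ks) =
  ∣-trans (*-monoʳ-∣ (k !) (factorialProduct∣sum! ks)) k!*[Σks]!∣[k+Σks]!
  where
  k!*[Σks]!∣[k+Σks]! : k ! * (sum ks) ! ∣ (k + sum ks) !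
  k!*[Σks]!∣[k+Σks]! =
    subst (λ t → k ! * t ! ∣ (k + sum ks) !) (m+n∸m≡n k (sum ks))
          (k![n∸k]!∣n! (m≤m+n k (sum ks)))

binomial∣multinomial : ∀ {m} k (ks : Vec ℕ m) →
  ((k + sum ks) C k) ∣ multinomial (k + sum ks) (k ∷ ks)
binomial∣multinomial k ks =
  m*n∣o⇒m∣o/n (n C k) (factorialProduct (k ∷ ks)) {{factorialProduct≢0 (k ∷ ks)}}
    (subst ((n C k) * factorialProduct (k ∷ ks) ∣_)
           (binomial*factorials≡factorial (m≤m+n k (sum ks)))
           (*-monoʳ-∣ (n C k) (*-monoʳ-∣ (k !) factorialProduct∣[n∸k]!)))
  where
  n = k + sum ks
  factorialProduct∣[n∸k]! : factorialProduct ks ∣ (n ∸ k) !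
  factorialProduct∣[n∸k]! =
    subst (λ t → factorialProduct ks ∣ t !) (sym (m+n∸m≡n k (sum ks)))
          (factorialProduct∣sum! ks)

-- The case of an
-- empty list of parts needs no clause: it would force n = 0, contradicting 1 ≤ n.
proposition6p1 : (n : ℕ) → 1 ≤ n → (p q : ℕ) → Prime p → Prime q →
    ((k : ℕ) → 1 ≤ k → k ≤ n ∸ 1 → p ∣ (n C k) ⊎ q ∣ (n C k)) →
    (m : ℕ) → m ≤ n → (ks : Vec ℕ m) →
    All (λ k → 1 ≤ k × k ≤ n ∸ 1) ks → sum ks ≡ n →
    p ∣ multinomial n ks ⊎ q ∣ multinomial n ks
proposition6p1 .(k + sum ks) _ p q _ _ pOrQ∣binomial (suc m) _ (k ∷ ks)
               ((1≤k , k≤n∸1) ∷ _) refl =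
  map (λ p∣ → ∣-trans p∣ (binomial∣multinomial k ks))
      (λ q∣ → ∣-trans q∣ (binomial∣multinomial k ks))
      (pOrQ∣binomial k 1≤k k≤n∸1)
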